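{- Let $p$ be an odd prime number. Then \[ h\left( \frac{p-1}{2} \right) = \frac{p+1}{2}. \] If $b$ is an odd integer with $b \geq 3$ and $p > (b-1)^2$, then \[ h\left( \frac{p-b}{2} \right) = \frac{p}{b} + \frac{(b-2)r}{2b}, \] where $r = (p+b) \bmod 2b$.
   Context: For an integer $x$ and a positive integer $n$, $x \bmod n$ denotes the least nonnegative integer congruent to $x$ modulo $n$. For an odd prime $p$ and $a \in \{0,1,\ldots,p-1\}$ the height is defined by $h(a) = \min\{ k + (ka \bmod p) : k = 1,2,\ldots,p-1\}$. -}

module Defs where

open import Data.Nat using (ℕ; zero; suc; _+_; _*_; _∸_; _⊓_; NonZero)
open import Data.Nat.DivMod using (_%_)

-- minOver f m = min { f k : k = 1, 2, ..., m }   (for m ≥ 1; minOver f 0 = 0 is unused)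
minOver : (ℕ → ℕ) → ℕ → ℕ
minOver f zero = 0
minOver f (suc zero) = f 1
minOver f (suc (suc m)) = minOver f (suc m) ⊓ f (suc (suc m))

height : (p : ℕ) .{{_ : NonZero p}} → ℕ → ℕ
height p a = minOver (λ k → k + (k * a) % p) (p ∸ 1)

-- x mod (2b), for b ≥ 1 (the case b = 0 never arises; returned value is irrelevant)
modDouble : ℕ → ℕ → ℕ
modDouble x zero = x
modDouble x (suc b) = x % (2 * suc b)

module Submission where

-- For k ≥ 1 put ρ = k a mod p. As b + 2a = p, we have 2ρ + k b ≡ k p ≡ 0 (mod p), say 2ρ + k b = c p
-- with c ≥ 1. For b = 1 this gives 2(k + ρ) = c p + k ≥ p + 1, with equality at k = 1.
-- For odd b = 2 + d write a = s + t b with s < b, so that p = (2t + 1) b + 2s and (p + b) mod 2b = 2s;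
-- then 2b(k + ρ) = 2cp + 2dρ. If c ≥ 2 this is at least 4p ≥ 2p + 2ds, because ds < (b - 1)² < p.
-- If c = 1 then ρ ≥ s: otherwise (k − 2t − 1) b = 2(s − ρ) lies strictly between 0 and 2b, forcing
-- the odd number b to be even. Equality holds at k = 2t + 1, where ρ = s.
-- Primality of p is used only through p > 1.

open import Defs
open import Data.Nat using (ℕ; _+_; _*_; _∸_; _^_; _≤_; _<_; NonZero; _/_; _%_)
open import Data.Nat.Primality using (Prime)
open import Data.Product using (_×_)
open import Relation.Binary.PropositionalEquality using (_≡_)

open import Data.Nat using (zero; suc; z≤n; s≤s; nonTrivial⇒n>1; >-nonZero)
open import Data.Nat.Properties
open import Data.Nat.DivMod
open import Data.Nat.Divisibility using (_∣_; divides; ∣m+n∣m⇒∣n; n∣m*n)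
open import Data.Nat.Primality using (prime⇒nonTrivial)
open import Data.Nat.Tactic.RingSolver using (solve)
open import Data.List.Base using (_∷_; [])
open import Data.Product using (∃-syntax; _,_)
open import Data.Sum using ([_,_]′)
open import Relation.Nullary using (contradiction; yes; no)
open import Relation.Binary.PropositionalEquality using (_≢_; refl; sym; trans; cong; subst; module ≡-Reasoning)

minOver-≤ : ∀ (f : ℕ → ℕ) m {k} → 1 ≤ k → k ≤ m → minOver f m ≤ f k
minOver-≤ f (suc zero) (s≤s z≤n) (s≤s z≤n) = ≤-refl
minOver-≤ f (suc (suc m)) 1≤k k≤2+m =
  [ (λ k<2+m → ≤-trans (m⊓n≤m _ _) (minOver-≤ f (suc m) 1≤k (≤-pred k<2+m)))
  , (λ k≡2+m → ≤-trans (m⊓n≤n _ _) (≤-reflexive (cong f (sym k≡2+m))))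
  ]′ (m≤n⇒m<n∨m≡n k≤2+m)

minOver-attained : ∀ (f : ℕ → ℕ) m → 1 ≤ m → ∃[ k ] 1 ≤ k × k ≤ m × minOver f m ≡ f k
minOver-attained f (suc zero) _ = 1 , ≤-refl , ≤-refl , refl
minOver-attained f (suc (suc m)) _ =
  [ (λ eq → let k , 1≤k , k≤1+m , eq′ = minOver-attained f (suc m) (s≤s z≤n)
            in k , 1≤k , m≤n⇒m≤1+n k≤1+m , trans eq eq′)
  , (λ eq → suc (suc m) , s≤s z≤n , ≤-refl , eq)
  ]′ (⊓-sel (minOver f (suc m)) (f (suc (suc m))))

*-minOver≡ : ∀ (f : ℕ → ℕ) {m} n {v} k₀ → 1 ≤ k₀ → k₀ ≤ m → n * f k₀ ≡ v →
             (∀ {k} → 1 ≤ k → v ≤ n * f k) → n * minOver f m ≡ v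
*-minOver≡ f {m} n {v} k₀ 1≤k₀ k₀≤m nfk₀≡v v≤nf = ≤-antisym upper lower
  where
  upper : n * minOver f m ≤ v
  upper = subst (n * minOver f m ≤_) nfk₀≡v (*-monoʳ-≤ n (minOver-≤ f m 1≤k₀ k₀≤m))
  lower : v ≤ n * minOver f m
  lower = let k , 1≤k , _ , eq = minOver-attained f m (≤-trans 1≤k₀ k₀≤m)
          in subst (λ x → v ≤ n * x) (sym eq) (v≤nf 1≤k)

*-height≡ : ∀ p .{{_ : NonZero p}} a n {v} k₀ → 1 ≤ k₀ → k₀ < p →
            n * (k₀ + k₀ * a % p) ≡ v → (∀ {k} → 1 ≤ k → v ≤ n * (k + k * a % p)) →
            n * height p a ≡ v
*-height≡ p a n k₀ 1≤k₀ k₀<p =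
  *-minOver≡ (λ k → k + k * a % p) n k₀ 1≤k₀ (<⇒≤pred k₀<p)

p∣2[ka%p]+kb : ∀ {p a b} .{{_ : NonZero p}} k → b + 2 * a ≡ p → p ∣ 2 * (k * a % p) + k * b
p∣2[ka%p]+kb {p} {a} {b} k b+2a≡p
  with k * a % p | k * a / p | m≡m%n+[m/n]*n (k * a) p
... | ρ | q | ka≡ = ∣m+n∣m⇒∣n (divides k kp≡) (n∣m*n (2 * q))
  where
  open ≡-Reasoning
  kp≡ : 2 * q * p + (2 * ρ + k * b) ≡ k * p
  kp≡ = begin
    2 * q * p + (2 * ρ + k * b)  ≡⟨ solve (q ∷ p ∷ ρ ∷ k ∷ b ∷ []) ⟩
    k * b + 2 * (ρ + q * p)      ≡⟨ cong (λ x → k * b + 2 * x) (sym ka≡) ⟩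
    k * b + 2 * (k * a)          ≡⟨ solve (k ∷ b ∷ a ∷ []) ⟩
    k * (b + 2 * a)              ≡⟨ cong (k *_) b+2a≡p ⟩
    k * p                        ∎

2ρ+kb≡cp⇒1≤c : ∀ ρ {k b c p} → 1 ≤ k → 1 ≤ b → 2 * ρ + k * b ≡ c * p → 1 ≤ c
2ρ+kb≡cp⇒1≤c _ {c = suc _} _ _ _ = s≤s z≤n
2ρ+kb≡cp⇒1≤c ρ {k} {b} {zero} 1≤k 1≤b eq
  with () ← ≤-trans (*-mono-≤ 1≤k 1≤b) (subst (k * b ≤_) eq (m≤n+m (k * b) (2 * ρ)))

p+1≤2[k+ρ] : ∀ {p ρ k c} → 1 ≤ k → 2 * ρ + k * 1 ≡ c * p → p + 1 ≤ 2 * (k + ρ)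
p+1≤2[k+ρ] {p} {ρ} {k} {c} 1≤k eq = begin
  p + 1              ≤⟨ +-mono-≤ (m≤n*m p c {{>-nonZero (2ρ+kb≡cp⇒1≤c ρ 1≤k ≤-refl eq)}}) 1≤k ⟩
  c * p + k          ≡⟨ cong (_+ k) (sym eq) ⟩
  2 * ρ + k * 1 + k  ≡⟨ solve (ρ ∷ k ∷ []) ⟩
  2 * (k + ρ)        ∎
  where open ≤-Reasoning

2*height[a]≡p+1 : ∀ {p a} .{{_ : NonZero p}} → 1 + 2 * a ≡ p → 1 < p → 2 * height p a ≡ p + 1
2*height[a]≡p+1 {p} {a} 1+2a≡p 1<p = *-height≡ p a 2 1 ≤-refl 1<p witness lower
  where
  open ≡-Reasoning
  a<p : a < p
  a<p = subst (a <_) 1+2a≡p (s≤s (m≤m+n a (a + 0)))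
  witness : 2 * (1 + 1 * a % p) ≡ p + 1
  witness = begin
    2 * (1 + 1 * a % p)  ≡⟨ cong (λ x → 2 * (1 + x % p)) (*-identityˡ a) ⟩
    2 * (1 + a % p)      ≡⟨ cong (λ x → 2 * (1 + x)) (m<n⇒m%n≡m a<p) ⟩
    2 * (1 + a)          ≡⟨ solve (a ∷ []) ⟩
    1 + 2 * a + 1        ≡⟨ cong (_+ 1) 1+2a≡p ⟩
    p + 1                ∎
  lower : ∀ {k} → 1 ≤ k → p + 1 ≤ 2 * (k + k * a % p)
  lower {k} 1≤k with p∣2[ka%p]+kb k 1+2a≡p
  ... | divides c eq = p+1≤2[k+ρ] {c = c} 1≤k eq

d*s<[1+d]^2 : ∀ {d s} → s ≤ 1 + d → d * s < (1 + d) ^ 2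
d*s<[1+d]^2 {d} {s} s≤1+d = begin-strict
  d * s                      ≤⟨ *-monoʳ-≤ d s≤1+d ⟩
  d * (1 + d)                <⟨ m<m+n (d * (1 + d)) (s≤s z≤n) ⟩
  d * (1 + d) + (1 + d)      ≡⟨ solve (d ∷ []) ⟩
  (1 + d) * ((1 + d) * 1)    ∎
  where open ≤-Reasoning

2ρ+[1+j]b≢2s : ∀ {b s ρ} j → s < b → b % 2 ≡ 1 → 2 * ρ + (1 + j) * b ≢ 2 * s
2ρ+[1+j]b≢2s {b} {s} {ρ} zero s<b b-odd eq = contradiction (trans (sym b-odd) b%2≡0) λ ()
  where
  open ≡-Reasoning
  b+2ρ≡2s : b + ρ * 2 ≡ 2 * s
  b+2ρ≡2s = begin
    b + ρ * 2          ≡⟨ solve (b ∷ ρ ∷ []) ⟩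
    2 * ρ + 1 * b      ≡⟨ eq ⟩
    2 * s              ∎
  b%2≡0 : b % 2 ≡ 0
  b%2≡0 = begin
    b % 2              ≡⟨ sym ([m+kn]%n≡m%n b ρ 2) ⟩
    (b + ρ * 2) % 2    ≡⟨ cong (_% 2) b+2ρ≡2s ⟩
    (2 * s) % 2        ≡⟨ cong (_% 2) (*-comm 2 s) ⟩
    (s * 2) % 2        ≡⟨ m*n%n≡0 s 2 ⟩
    0                  ∎
2ρ+[1+j]b≢2s {b} {s} {ρ} (suc j) s<b _ eq = <⇒≱ s<b (*-cancelˡ-≤ 2 (begin
  2 * b                    ≤⟨ *-monoˡ-≤ b (m≤m+n 2 j) ⟩
  (2 + j) * b              ≤⟨ m≤n+m _ (2 * ρ) ⟩
  2 * ρ + (2 + j) * b      ≡⟨ eq ⟩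
  2 * s                    ∎))
  where open ≤-Reasoning

2ρ+kb≡[1+2t]b+2s⇒s≤ρ : ∀ {b s t ρ k} → s < b → b % 2 ≡ 1 →
                        2 * ρ + k * b ≡ (1 + 2 * t) * b + 2 * s → s ≤ ρ
2ρ+kb≡[1+2t]b+2s⇒s≤ρ {b} {s} {t} {ρ} {k} s<b b-odd eq with k ≤? 1 + 2 * t
... | yes k≤1+2t with m≤n⇒∃[o]m+o≡n k≤1+2t
...   | e , k+e≡1+2t = *-cancelˡ-≤ 2 (subst (2 * s ≤_) (sym 2ρ≡) (m≤n+m (2 * s) (e * b)))
  where
  open ≡-Reasoning
  2ρ≡ : 2 * ρ ≡ e * b + 2 * s
  2ρ≡ = +-cancelʳ-≡ (k * b) (2 * ρ) (e * b + 2 * s) (begin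
    2 * ρ + k * b              ≡⟨ eq ⟩
    (1 + 2 * t) * b + 2 * s    ≡⟨ cong (λ x → x * b + 2 * s) (sym k+e≡1+2t) ⟩
    (k + e) * b + 2 * s        ≡⟨ solve (k ∷ e ∷ b ∷ s ∷ []) ⟩
    e * b + 2 * s + k * b      ∎)
2ρ+kb≡[1+2t]b+2s⇒s≤ρ {b} {s} {t} {ρ} s<b b-odd eq | no k≰1+2t
  with m≤n⇒∃[o]m+o≡n (≰⇒> k≰1+2t)
...   | j , refl = contradiction (+-cancelʳ-≡ ((1 + 2 * t) * b) _ _ (begin
    2 * ρ + (1 + j) * b + (1 + 2 * t) * b    ≡⟨ solve (ρ ∷ j ∷ b ∷ t ∷ []) ⟩
    2 * ρ + (2 + 2 * t + j) * b              ≡⟨ eq ⟩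
    (1 + 2 * t) * b + 2 * s                  ≡⟨ +-comm _ (2 * s) ⟩
    2 * s + (1 + 2 * t) * b                  ∎)) (2ρ+[1+j]b≢2s {ρ = ρ} j s<b b-odd)
    where open ≡-Reasoning

2p+d[2s]≤2[2+d][k+ρ] : ∀ {d s t p ρ k c} → (1 + 2 * t) * (2 + d) + 2 * s ≡ p → s < 2 + d →
                       (2 + d) % 2 ≡ 1 → (1 + d) ^ 2 < p → 1 ≤ k → 2 * ρ + k * (2 + d) ≡ c * p →
                       2 * p + d * (2 * s) ≤ 2 * (2 + d) * (k + ρ)
2p+d[2s]≤2[2+d][k+ρ] {d} {s} {t} {p} {ρ} {k} {c} p≡ s<b b-odd [1+d]²<p 1≤k eq = begin
  2 * p + d * (2 * s)                   ≤⟨ bound c (2ρ+kb≡cp⇒1≤c ρ 1≤k (s≤s z≤n) eq) eq ⟩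
  2 * (c * p) + d * (2 * ρ)             ≡⟨ cong (λ x → 2 * x + d * (2 * ρ)) (sym eq) ⟩
  2 * (2 * ρ + k * (2 + d)) + d * (2 * ρ) ≡⟨ solve (ρ ∷ k ∷ d ∷ []) ⟩
  2 * (2 + d) * (k + ρ)                 ∎
  where
  open ≤-Reasoning
  bound : ∀ c → 1 ≤ c → 2 * ρ + k * (2 + d) ≡ c * p → 2 * p + d * (2 * s) ≤ 2 * (c * p) + d * (2 * ρ)
  bound 1 _ eq₁ = +-mono-≤ (≤-reflexive (cong (2 *_) (sym (*-identityˡ p))))
                           (*-monoʳ-≤ d (*-monoʳ-≤ 2 s≤ρ))
    where
    s≤ρ : s ≤ ρ
    s≤ρ = 2ρ+kb≡[1+2t]b+2s⇒s≤ρ {t = t} {ρ} {k} s<b b-odd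
            (trans eq₁ (trans (*-identityˡ p) (sym p≡)))
  bound (suc (suc c′)) _ _ = begin
    2 * p + d * (2 * s)         ≤⟨ +-monoʳ-≤ (2 * p) 2ds≤2p ⟩
    2 * p + 2 * p               ≡⟨ solve (p ∷ []) ⟩
    2 * (2 * p)                 ≤⟨ *-monoʳ-≤ 2 (*-monoˡ-≤ p (m≤m+n 2 c′)) ⟩
    2 * ((2 + c′) * p)          ≤⟨ m≤m+n _ (d * (2 * ρ)) ⟩
    2 * ((2 + c′) * p) + d * (2 * ρ) ∎
    where
    2ds≤2p : d * (2 * s) ≤ 2 * p
    2ds≤2p = begin
      d * (2 * s)  ≡⟨ solve (d ∷ s ∷ []) ⟩
      2 * (d * s)  ≤⟨ *-monoʳ-≤ 2 (<⇒≤ (<-trans (d*s<[1+d]^2 (≤-pred s<b)) [1+d]²<p)) ⟩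
      2 * p        ∎

[1+2t][s+tb]%p≡s : ∀ {b s t p} .{{_ : NonZero p}} → (1 + 2 * t) * b + 2 * s ≡ p → s < p →
                   (1 + 2 * t) * (s + t * b) % p ≡ s
[1+2t][s+tb]%p≡s {b} {s} {t} {p} p≡ s<p = begin
  (1 + 2 * t) * (s + t * b) % p ≡⟨ cong (_% p) ka≡s+tp ⟩
  (s + t * p) % p               ≡⟨ [m+kn]%n≡m%n s t p ⟩
  s % p                         ≡⟨ m<n⇒m%n≡m s<p ⟩
  s                             ∎
  where
  open ≡-Reasoning
  ka≡s+tp : (1 + 2 * t) * (s + t * b) ≡ s + t * p
  ka≡s+tp = begin
    (1 + 2 * t) * (s + t * b)         ≡⟨ solve (t ∷ s ∷ b ∷ []) ⟩
    s + t * ((1 + 2 * t) * b + 2 * s) ≡⟨ cong (λ x → s + t * x) p≡ ⟩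
    s + t * p                         ∎

2[2+d]*height[s+t[2+d]]≡2p+d[2s] :
  ∀ d s t {p} .{{_ : NonZero p}} → (1 + 2 * t) * (2 + d) + 2 * s ≡ p → s < 2 + d →
  (2 + d) % 2 ≡ 1 → (1 + d) ^ 2 < p →
  2 * (2 + d) * height p (s + t * (2 + d)) ≡ 2 * p + d * (2 * s)
2[2+d]*height[s+t[2+d]]≡2p+d[2s] d s t {p} p≡ s<b b-odd [1+d]²<p =
  *-height≡ p a (2 * b) k₀ (s≤s z≤n) k₀<p witness lower
  where
  b a k₀ : ℕ
  b = 2 + d
  a = s + t * b
  k₀ = 1 + 2 * t
  b+2a≡p : b + 2 * a ≡ p
  b+2a≡p = begin
    2 + d + 2 * (s + t * (2 + d))   ≡⟨ solve (d ∷ s ∷ t ∷ []) ⟩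
    (1 + 2 * t) * (2 + d) + 2 * s   ≡⟨ p≡ ⟩
    p                               ∎
    where open ≡-Reasoning
  s<p : s < p
  s<p = subst (s <_) b+2a≡p (<-≤-trans s<b (m≤m+n b (2 * a)))
  k₀<p : k₀ < p
  k₀<p = begin-strict
    k₀                               <⟨ m<m+n k₀ (s≤s z≤n) ⟩
    k₀ + k₀ * (1 + d)                ≤⟨ m≤m+n _ (2 * s) ⟩
    1 + 2 * t + (1 + 2 * t) * (1 + d) + 2 * s ≡⟨ solve (t ∷ d ∷ s ∷ []) ⟩
    (1 + 2 * t) * (2 + d) + 2 * s    ≡⟨ p≡ ⟩
    p                                ∎
    where open ≤-Reasoning
  witness : 2 * b * (k₀ + k₀ * a % p) ≡ 2 * p + d * (2 * s)
  witness = begin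
    2 * b * (k₀ + k₀ * a % p)        ≡⟨ cong (λ x → 2 * b * (k₀ + x)) ([1+2t][s+tb]%p≡s {b} {s} {t} p≡ s<p) ⟩
    2 * (2 + d) * (1 + 2 * t + s)    ≡⟨ solve (d ∷ t ∷ s ∷ []) ⟩
    2 * ((1 + 2 * t) * (2 + d) + 2 * s) + d * (2 * s) ≡⟨ cong (λ x → 2 * x + d * (2 * s)) p≡ ⟩
    2 * p + d * (2 * s)              ∎
    where open ≡-Reasoning
  lower : ∀ {k} → 1 ≤ k → 2 * p + d * (2 * s) ≤ 2 * b * (k + k * a % p)
  lower {k} 1≤k with p∣2[ka%p]+kb k b+2a≡p
  ... | divides c eq = 2p+d[2s]≤2[2+d][k+ρ] {t = t} {c = c} p≡ s<b b-odd [1+d]²<p 1≤k eq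

modDouble[p+b]b≡2s : ∀ {b s t p} → (1 + 2 * t) * suc b + 2 * s ≡ p → s < suc b →
                     modDouble (p + suc b) (suc b) ≡ 2 * s
modDouble[p+b]b≡2s {b} {s} {t} {p} p≡ s<b = begin
  (p + suc b) % (2 * suc b)
    ≡⟨ cong (λ x → (x + suc b) % (2 * suc b)) (sym p≡) ⟩
  ((1 + 2 * t) * suc b + 2 * s + suc b) % (2 * suc b)
    ≡⟨ cong (_% (2 * suc b)) regroup ⟩
  (2 * s + (1 + t) * (2 * suc b)) % (2 * suc b)
    ≡⟨ [m+kn]%n≡m%n (2 * s) (1 + t) (2 * suc b) ⟩
  (2 * s) % (2 * suc b)
    ≡⟨ m<n⇒m%n≡m (*-monoʳ-< 2 s<b) ⟩
  2 * s
    ∎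
  where
  open ≡-Reasoning
  regroup : (1 + 2 * t) * suc b + 2 * s + suc b ≡ 2 * s + (1 + t) * (2 * suc b)
  regroup = solve (t ∷ b ∷ s ∷ [])

2[2+d]*height[a]≡2p+d*modDouble :
  ∀ d {p a} .{{_ : NonZero p}} → 2 + d + 2 * a ≡ p → (2 + d) % 2 ≡ 1 → (1 + d) ^ 2 < p →
  2 * (2 + d) * height p a ≡ 2 * p + d * modDouble (p + (2 + d)) (2 + d)
2[2+d]*height[a]≡2p+d*modDouble d {p} {a} b+2a≡p b-odd [1+d]²<p
  with a % (2 + d) | a / (2 + d) | m≡m%n+[m/n]*n a (2 + d) | m%n<n a (2 + d)
... | s | t | refl | s<b = begin
  2 * (2 + d) * height p (s + t * (2 + d))  ≡⟨ 2[2+d]*height[s+t[2+d]]≡2p+d[2s] d s t p≡ s<b b-odd [1+d]²<p ⟩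
  2 * p + d * (2 * s)                       ≡⟨ cong (λ r → 2 * p + d * r) (sym (modDouble[p+b]b≡2s {t = t} p≡ s<b)) ⟩
  2 * p + d * modDouble (p + (2 + d)) (2 + d) ∎
  where
  open ≡-Reasoning
  p≡ : (1 + 2 * t) * (2 + d) + 2 * s ≡ p
  p≡ = begin
    (1 + 2 * t) * (2 + d) + 2 * s   ≡⟨ solve (t ∷ d ∷ s ∷ []) ⟩
    2 + d + 2 * (s + t * (2 + d))   ≡⟨ b+2a≡p ⟩
    p                               ∎

m+2[[n∸m]/2]≡n : ∀ {m n} → m ≤ n → m % 2 ≡ 1 → n % 2 ≡ 1 → m + 2 * ((n ∸ m) / 2) ≡ n
m+2[[n∸m]/2]≡n {m} {n} m≤n m-odd n-odd
  with (n ∸ m) % 2 | (n ∸ m) / 2 | m≡m%n+[m/n]*n (n ∸ m) 2 | m%n<n (n ∸ m) 2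
... | 0 | q | n∸m≡q*2 | _ = begin
  m + 2 * q     ≡⟨ cong (m +_) (trans (*-comm 2 q) (sym n∸m≡q*2)) ⟩
  m + (n ∸ m)   ≡⟨ m+[n∸m]≡n m≤n ⟩
  n             ∎
  where open ≡-Reasoning
... | 1 | q | n∸m≡1+q*2 | _ = contradiction (trans (sym n-odd) n-even) λ ()
  where
  open ≡-Reasoning
  n-even : n % 2 ≡ 0
  n-even = begin
    n % 2                        ≡⟨ cong (_% 2) (sym (m+[n∸m]≡n m≤n)) ⟩
    (m + (n ∸ m)) % 2            ≡⟨ cong (λ x → (m + x) % 2) n∸m≡1+q*2 ⟩
    (m + (1 + q * 2)) % 2        ≡⟨ cong (_% 2) (sym (+-assoc m 1 (q * 2))) ⟩
    (m + 1 + q * 2) % 2          ≡⟨ [m+kn]%n≡m%n (m + 1) q 2 ⟩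
    (m + 1) % 2                  ≡⟨ %-distribˡ-+ m 1 2 ⟩
    (m % 2 + 1 % 2) % 2          ≡⟨ cong (λ x → (x + 1 % 2) % 2) m-odd ⟩
    0                            ∎
... | suc (suc _) | _ | _ | s≤s (s≤s ())

m≤[m∸1]^2 : ∀ {m} → 3 ≤ m → m ≤ (m ∸ 1) ^ 2
m≤[m∸1]^2 {suc (suc (suc e))} (s≤s (s≤s (s≤s _))) = begin
  3 + e                        ≤⟨ m≤m+n (3 + e) (1 + 3 * e + e * e) ⟩
  3 + e + (1 + 3 * e + e * e)  ≡⟨ solve (e ∷ []) ⟩
  (2 + e) * ((2 + e) * 1)      ∎
  where open ≤-Reasoning

mainTheorem7 : (p : ℕ) .{{_ : NonZero p}} → Prime p → p % 2 ≡ 1 →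
    (height p ((p ∸ 1) / 2) ≡ (p + 1) / 2)
    × ((b : ℕ) → b % 2 ≡ 1 → 3 ≤ b → (b ∸ 1) ^ 2 < p →
        2 * b * height p ((p ∸ b) / 2) ≡ 2 * p + (b ∸ 2) * modDouble (p + b) b)
mainTheorem7 p p-prime p-odd = height-at-[p∸1]/2 , height-at-[p∸b]/2
  where
  open ≡-Reasoning
  h : ℕ
  h = height p ((p ∸ 1) / 2)
  height-at-[p∸1]/2 : h ≡ (p + 1) / 2
  height-at-[p∸1]/2 = begin
    h            ≡⟨ sym (m*n/n≡m h 2) ⟩
    h * 2 / 2    ≡⟨ cong (_/ 2) (trans (*-comm h 2) (2*height[a]≡p+1 1+2a≡p 1<p)) ⟩
    (p + 1) / 2  ∎
    where
    1<p : 1 < p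
    1<p = nonTrivial⇒n>1 p {{prime⇒nonTrivial p-prime}}
    1+2a≡p : 1 + 2 * ((p ∸ 1) / 2) ≡ p
    1+2a≡p = m+2[[n∸m]/2]≡n (<⇒≤ 1<p) refl p-odd
  height-at-[p∸b]/2 : (b : ℕ) → b % 2 ≡ 1 → 3 ≤ b → (b ∸ 1) ^ 2 < p →
           2 * b * height p ((p ∸ b) / 2) ≡ 2 * p + (b ∸ 2) * modDouble (p + b) b
  height-at-[p∸b]/2 b b-odd 3≤b@(s≤s (s≤s (s≤s _))) [b∸1]²<p =
    2[2+d]*height[a]≡2p+d*modDouble (b ∸ 2) b+2a≡p b-odd [b∸1]²<p
    where
    b+2a≡p : b + 2 * ((p ∸ b) / 2) ≡ p
    b+2a≡p = m+2[[n∸m]/2]≡n (<⇒≤ (≤-<-trans (m≤[m∸1]^2 3≤b) [b∸1]²<p)) b-odd p-odd
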